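{- For all integers $n\ge1$, $m$, $r$ with $m+1\ge 2r\ge1$, \[ \sum_{k=0}^{n}(-1)^{k}\genfrac{\{}{\}}{0pt}{}{n}{k}_{m}\mathfrak{L}_{k,r}(x-1)=w_{n,m+1-2r}(-x). \]
   Context: For a real number $r$, the $r$-Lah numbers are defined by $\frac{1}{k!}\left(\frac{t}{1-t}\right)^k\left(\frac{1}{1-t}\right)^{2r}=\sum_{n\ge k}\genfrac{\lfloor}{\rfloor}{0pt}{}{n}{k}_r\frac{t^n}{n!}$, and the geometric $r$-Lah polynomials are $\mathfrak{L}_{n,r}(x)=\sum_{k=0}^n\genfrac{\lfloor}{\rfloor}{0pt}{}{n}{k}_r k!\,x^k$. The $r$-Stirling numbers of the second kind are defined by $(x+m)^n=\sum_{k=0}^n\genfrac{\{}{\}}{0pt}{}{n}{k}_m x(x-1)\cdots(x-k+1)$. The $r$-geometric polynomials $w_{n,r}(x)$ are defined by $\sum_{n\ge0}w_{n,r}(x)\frac{t^n}{n!}=\frac{e^{rt}}{1-x(e^t-1)}$. -}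

module Defs where

open import Data.Nat as ℕ using (ℕ; zero; suc; _!; _∸_)
open import Data.Nat.Properties using (_!≢0)
open import Data.Integer using (+_)
open import Data.Rational using (ℚ; 0ℚ; 1ℚ; _+_; _*_; -_; _-_; _/_)

ℕ→ℚ : ℕ → ℚ
ℕ→ℚ n = + n / 1

_^ᵠ_ : ℚ → ℕ → ℚ
q ^ᵠ zero  = 1ℚ
q ^ᵠ suc n = q * (q ^ᵠ n)

inv! : ℕ → ℚ
inv! n = _/_ (+ 1) (n !) {{n !≢0}}

sumTo : ℕ → (ℕ → ℚ) → ℚ
sumTo zero    f = f 0
sumTo (suc n) f = sumTo n f + f (suc n)

-- Formal power series in t over ℚ, as coefficient sequences
-- (ordinary coefficients: f n = [t^n] f).

Series : Set
Series = ℕ → ℚ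

_⊛_ : Series → Series → Series
(f ⊛ g) n = sumTo n (λ i → f i * g (n ∸ i))

scale : ℚ → Series → Series
scale c f n = c * f n

oneS : Series
oneS zero    = 1ℚ
oneS (suc _) = 0ℚ

powS : Series → ℕ → Series
powS f zero    = oneS
powS f (suc k) = f ⊛ powS f k

-- 1/(1 - u) = Σ_{k≥0} u^k for a series u with zero constant term;
-- since u^k has order ≥ k, the t^n coefficient only involves k ≤ n.
geomS : Series → Series
geomS u n = sumTo n (λ k → powS u k n)

invOneMinusT : Series
invOneMinusT _ = 1ℚ

tOverOneMinusT : Series
tOverOneMinusT zero    = 0ℚ
tOverOneMinusT (suc _) = 1ℚ

expS : ℚ → Series
expS s n = (s ^ᵠ n) * inv! n

expm1S : Series
expm1S zero    = 0ℚ
expm1S (suc n) = inv! (suc n)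

-- r-Lah numbers (for natural r), via their exponential generating function
--   (1/k!) (t/(1-t))^k (1/(1-t))^{2r} = Σ_{n≥k} ⌊n,k⌋_r t^n / n!
rLah : ℕ → ℕ → ℕ → ℚ
rLah r n k =
  ℕ→ℚ (n !) * (scale (inv! k) (powS tOverOneMinusT k ⊛ powS invOneMinusT (2 ℕ.* r))) n

geomLah : ℕ → ℕ → ℚ → ℚ
geomLah n r x = sumTo n (λ k → rLah r n k * ℕ→ℚ (k !) * (x ^ᵠ k))

-- r-Stirling numbers of the second kind {n,k}_m (m ∈ ℕ), characterised by
--   (x+m)^n = Σ_k {n,k}_m x(x-1)...(x-k+1);
-- computed by the standard recurrence
--   {0,0}_m = 1, {0,k+1}_m = 0, {n+1,0}_m = m {n,0}_m,
--   {n+1,k+1}_m = {n,k}_m + (k+1+m) {n,k+1}_m.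
rStirling2 : ℕ → ℕ → ℕ → ℕ
rStirling2 m zero    zero    = 1
rStirling2 m zero    (suc k) = 0
rStirling2 m (suc n) zero    = m ℕ.* rStirling2 m n zero
rStirling2 m (suc n) (suc k) =
  rStirling2 m n k ℕ.+ (suc k ℕ.+ m) ℕ.* rStirling2 m n (suc k)

-- r-geometric polynomials, via
--   Σ_n w_{n,r}(x) t^n/n! = e^{rt} / (1 - x(e^t - 1))
rGeom : ℕ → ℕ → ℚ → ℚ
rGeom n r x = ℕ→ℚ (n !) * (expS (ℕ→ℚ r) ⊛ geomS (scale x expm1S)) n

-- Both sides are expanded in powers of x, with s = m + 1 − 2r and α = 2r − 1, so that m = s + α.
--
-- Right-hand side: n! [tⁿ] e^{st}(eᵗ − 1)ʲ = j! {n,j}_s, since differentiating in t shows that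
-- both sides obey the r-Stirling recurrence; hence w_{n,s}(−x) = Σ_j (−x)ʲ j! {n,j}_s.
--
-- Left-hand side: at y = x − 1 the Lah generating function collapses,
--   Σ_i yⁱ (t/(1−t))ⁱ (1−t)^{−2r} = (1−t)^{−α} / (1 − xt),
-- so 𝔏_{k,r}(x−1) = Σ_j xʲ k! [t^{k−j}](1−t)^{−α}. Summation by parts against the recurrence of
-- {n,k}_m, together with (k+1) [t^{k+1}](1−t)^{−α} = (k+α) [tᵏ](1−t)^{−α}, shows that
-- Σ_k (−1)ᵏ {n,k}_m k! [t^{k−j}](1−t)^{−α} obeys the same recurrence in (n, j) as (−1)ʲ j! {n,j}_s,
-- so the two agree and the sides match term by term.

{-# OPTIONS --safe #-}
module Submission where

open import Defs
open import Data.Nat using (ℕ; _≤_; _∸_)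
open import Data.Rational using (ℚ; 1ℚ; _+_; _*_; -_; _-_)
open import Relation.Binary.PropositionalEquality using (_≡_)

open import Data.Nat as ℕ using (zero; suc; _!; _<_; z≤n; s≤s)
open import Data.Nat.Properties as ℕ using (_!≢0)
open import Data.Nat.Coprimality as Coprime using (1-coprimeTo)
import Data.Integer as ℤ
import Data.Integer.Properties as ℤ
open import Data.Rational using (mkℚ; 0ℚ; _/_; 1/_)
import Data.Rational.Properties as ℚ
open import Algebra.Bundles using (CommutativeMonoid)
open import Algebra.Properties.CommutativeSemigroup
  (CommutativeMonoid.commutativeSemigroup ℚ.*-1-commutativeMonoid) using (x∙yz≈y∙xz; xy∙z≈y∙xz)
open import Function using (_∘_; const)
open import Level using (0ℓ)
open import Relation.Binary.PropositionalEquality using (_≗_; refl; sym; trans; cong; cong₂; subst; module ≡-Reasoning)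
open import Relation.Nullary.Decidable using (dec⇒maybe)
open import Tactic.RingSolver using (solve-∀)
import Tactic.RingSolver.Core.AlmostCommutativeRing as ACR

ℚ-ring : ACR.AlmostCommutativeRing 0ℓ 0ℓ
ℚ-ring = ACR.fromCommutativeRing ℚ.+-*-commutativeRing (λ x → dec⇒maybe (0ℚ ℚ.≟ x))

-- Exposing the constructor lets ℚ's _+_ and _*_ compute on casts.
ℕ→ℚ≡mkℚ : ∀ n → ℕ→ℚ n ≡ mkℚ (ℤ.+ n) 0 (Coprime.sym (1-coprimeTo n))
ℕ→ℚ≡mkℚ n = ℚ.normalize-coprime _

ℕ→ℚ-+ : ∀ a b → ℕ→ℚ (a ℕ.+ b) ≡ ℕ→ℚ a + ℕ→ℚ b
ℕ→ℚ-+ a b = begin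
  ℤ.+ (a ℕ.+ b) / 1                          ≡⟨ cong (_/ 1) (cong₂ ℤ._+_ (ℤ.*-identityʳ (ℤ.+ a)) (ℤ.*-identityʳ (ℤ.+ b))) ⟨
  (ℤ.+ a ℤ.* ℤ.+ 1 ℤ.+ ℤ.+ b ℤ.* ℤ.+ 1) / 1  ≡⟨ cong₂ _+_ (ℕ→ℚ≡mkℚ a) (ℕ→ℚ≡mkℚ b) ⟨
  ℕ→ℚ a + ℕ→ℚ b                              ∎
  where open ≡-Reasoning

ℕ→ℚ-* : ∀ a b → ℕ→ℚ (a ℕ.* b) ≡ ℕ→ℚ a * ℕ→ℚ b
ℕ→ℚ-* a b = begin
  ℤ.+ (a ℕ.* b) / 1      ≡⟨ cong (_/ 1) (ℤ.pos-* a b) ⟩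
  (ℤ.+ a ℤ.* ℤ.+ b) / 1  ≡⟨ cong₂ _*_ (ℕ→ℚ≡mkℚ a) (ℕ→ℚ≡mkℚ b) ⟨
  ℕ→ℚ a * ℕ→ℚ b          ∎
  where open ≡-Reasoning

ℕ→ℚ-suc : ∀ n → ℕ→ℚ (suc n) ≡ 1ℚ + ℕ→ℚ n
ℕ→ℚ-suc = ℕ→ℚ-+ 1

ℕ→ℚ-*-1/ : ∀ d .{{_ : ℕ.NonZero d}} → ℕ→ℚ d * (ℤ.+ 1 / d) ≡ 1ℚ
ℕ→ℚ-*-1/ (suc k) = begin
  ℕ→ℚ (suc k) * (ℤ.+ 1 / suc k)  ≡⟨ cong₂ _*_ (ℕ→ℚ≡mkℚ (suc k)) (ℚ.normalize-coprime (1-coprimeTo (suc k))) ⟩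
  p * 1/ p                        ≡⟨ ℚ.*-inverseʳ p ⟩
  1ℚ                              ∎
  where
  open ≡-Reasoning
  p = mkℚ (ℤ.+ suc k) 0 (Coprime.sym (1-coprimeTo (suc k)))

n!*inv!≡1 : ∀ n → ℕ→ℚ (n !) * inv! n ≡ 1ℚ
n!*inv!≡1 n = ℕ→ℚ-*-1/ (n !) {{n !≢0}}

[1+n]*inv![1+n]≡inv!n : ∀ n → ℕ→ℚ (suc n) * inv! (suc n) ≡ inv! n
[1+n]*inv![1+n]≡inv!n n = begin
  a * i′                       ≡⟨ ℚ.*-identityˡ (a * i′) ⟨
  1ℚ * (a * i′)                ≡⟨ cong (_* (a * i′)) (n!*inv!≡1 n) ⟨
  ℕ→ℚ (n !) * i * (a * i′)     ≡⟨ regroup (ℕ→ℚ (n !)) i a i′ ⟩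
  a * ℕ→ℚ (n !) * i′ * i       ≡⟨ cong (λ z → z * i′ * i) (ℕ→ℚ-* (suc n) (n !)) ⟨
  ℕ→ℚ (suc n !) * i′ * i       ≡⟨ cong (_* i) (n!*inv!≡1 (suc n)) ⟩
  1ℚ * i                       ≡⟨ ℚ.*-identityˡ i ⟩
  i                            ∎
  where
  open ≡-Reasoning
  a = ℕ→ℚ (suc n)
  i = inv! n
  i′ = inv! (suc n)
  regroup : ∀ f i a i′ → f * i * (a * i′) ≡ a * f * i′ * i
  regroup = solve-∀ ℚ-ring

-1^_ : ℕ → ℚ
-1^ k = (- 1ℚ) ^ᵠ k

^ᵠ-zeroˡ : ∀ j → 1ℚ ^ᵠ j ≡ 1ℚ
^ᵠ-zeroˡ zero    = refl
^ᵠ-zeroˡ (suc j) = trans (ℚ.*-identityˡ (1ℚ ^ᵠ j)) (^ᵠ-zeroˡ j)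

neg-^ᵠ : ∀ x j → (- x) ^ᵠ j ≡ -1^ j * x ^ᵠ j
neg-^ᵠ x zero    = refl
neg-^ᵠ x (suc j) = begin
  (- x) * (- x) ^ᵠ j          ≡⟨ cong ((- x) *_) (neg-^ᵠ x j) ⟩
  (- x) * (-1^ j * x ^ᵠ j)    ≡⟨ regroup x (-1^ j) (x ^ᵠ j) ⟩
  - 1ℚ * -1^ j * (x * x ^ᵠ j) ∎
  where
  open ≡-Reasoning
  regroup : ∀ x a b → (- x) * (a * b) ≡ - 1ℚ * a * (x * b)
  regroup = solve-∀ ℚ-ring

x^j*[-1^j*q]≡[-x]^j*q : ∀ x j q → x ^ᵠ j * (-1^ j * q) ≡ (- x) ^ᵠ j * q
x^j*[-1^j*q]≡[-x]^j*q x j q = begin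
  x ^ᵠ j * (-1^ j * q)    ≡⟨ x∙yz≈y∙xz (x ^ᵠ j) (-1^ j) q ⟩
  -1^ j * (x ^ᵠ j * q)    ≡⟨ ℚ.*-assoc (-1^ j) (x ^ᵠ j) q ⟨
  -1^ j * x ^ᵠ j * q      ≡⟨ cong (_* q) (neg-^ᵠ x j) ⟨
  (- x) ^ᵠ j * q          ∎
  where open ≡-Reasoning

sumTo-cong : ∀ n {f g : ℕ → ℚ} → (∀ i → i ≤ n → f i ≡ g i) → sumTo n f ≡ sumTo n g
sumTo-cong zero    f≡g = f≡g 0 z≤n
sumTo-cong (suc n) f≡g =
  cong₂ _+_ (sumTo-cong n (λ i i≤n → f≡g i (ℕ.m≤n⇒m≤1+n i≤n))) (f≡g (suc n) ℕ.≤-refl)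

sumTo-0 : ∀ n → sumTo n (const 0ℚ) ≡ 0ℚ
sumTo-0 zero    = refl
sumTo-0 (suc n) = trans (ℚ.+-identityʳ _) (sumTo-0 n)

sumTo-const : ∀ n c → sumTo n (const c) ≡ ℕ→ℚ (suc n) * c
sumTo-const zero    c = sym (ℚ.*-identityˡ c)
sumTo-const (suc n) c = begin
  sumTo n (const c) + c             ≡⟨ cong (_+ c) (sumTo-const n c) ⟩
  ℕ→ℚ (suc n) * c + c               ≡⟨ regroup (ℕ→ℚ (suc n)) c ⟩
  (1ℚ + ℕ→ℚ (suc n)) * c            ≡⟨ cong (_* c) (ℕ→ℚ-suc (suc n)) ⟨
  ℕ→ℚ (suc (suc n)) * c             ∎
  where
  open ≡-Reasoning
  regroup : ∀ a c → a * c + c ≡ (1ℚ + a) * c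
  regroup = solve-∀ ℚ-ring

sumTo-+ : ∀ n (f g : ℕ → ℚ) → sumTo n (λ i → f i + g i) ≡ sumTo n f + sumTo n g
sumTo-+ zero    f g = refl
sumTo-+ (suc n) f g =
  trans (cong (_+ (f (suc n) + g (suc n))) (sumTo-+ n f g))
        (interchange (sumTo n f) (sumTo n g) (f (suc n)) (g (suc n)))
  where
  interchange : ∀ a b c d → (a + b) + (c + d) ≡ (a + c) + (b + d)
  interchange = solve-∀ ℚ-ring

sumTo-- : ∀ n (f g : ℕ → ℚ) → sumTo n (λ i → f i - g i) ≡ sumTo n f - sumTo n g
sumTo-- zero    f g = refl
sumTo-- (suc n) f g =
  trans (cong (_+ (f (suc n) - g (suc n))) (sumTo-- n f g))
        (interchange (sumTo n f) (sumTo n g) (f (suc n)) (g (suc n)))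
  where
  interchange : ∀ a b c d → (a - b) + (c - d) ≡ (a + c) - (b + d)
  interchange = solve-∀ ℚ-ring

sumTo-*ˡ : ∀ n c (f : ℕ → ℚ) → sumTo n (λ i → c * f i) ≡ c * sumTo n f
sumTo-*ˡ zero    c f = refl
sumTo-*ˡ (suc n) c f =
  trans (cong (_+ (c * f (suc n))) (sumTo-*ˡ n c f)) (sym (ℚ.*-distribˡ-+ c _ _))

sumTo-*ʳ : ∀ n c (f : ℕ → ℚ) → sumTo n (λ i → f i * c) ≡ sumTo n f * c
sumTo-*ʳ n c f = begin
  sumTo n (λ i → f i * c)  ≡⟨ sumTo-cong n (λ i _ → ℚ.*-comm (f i) c) ⟩
  sumTo n (λ i → c * f i)  ≡⟨ sumTo-*ˡ n c f ⟩
  c * sumTo n f            ≡⟨ ℚ.*-comm c (sumTo n f) ⟩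
  sumTo n f * c            ∎
  where open ≡-Reasoning

sumTo-head : ∀ n (f : ℕ → ℚ) → sumTo (suc n) f ≡ f 0 + sumTo n (f ∘ suc)
sumTo-head zero    f = refl
sumTo-head (suc n) f =
  trans (cong (_+ f (suc (suc n))) (sumTo-head n f)) (ℚ.+-assoc (f 0) _ _)

sumTo-shift-sub : ∀ n (h b : ℕ → ℚ) → h (suc n) ≡ 0ℚ →
  h 0 + sumTo n (λ k → h (suc k) - b k) ≡ sumTo n (λ k → h k - b k)
sumTo-shift-sub n h b h[1+n]≡0 = begin
  h 0 + sumTo n (λ k → h (suc k) - b k)  ≡⟨ cong (h 0 +_) (sumTo-- n (h ∘ suc) b) ⟩
  h 0 + (sumTo n (h ∘ suc) - sumTo n b)  ≡⟨ ℚ.+-assoc (h 0) _ _ ⟨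
  h 0 + sumTo n (h ∘ suc) - sumTo n b    ≡⟨ cong (_- sumTo n b) (sumTo-head n h) ⟨
  sumTo n h + h (suc n) - sumTo n b      ≡⟨ cong (λ z → sumTo n h + z - sumTo n b) h[1+n]≡0 ⟩
  sumTo n h + 0ℚ - sumTo n b             ≡⟨ cong (_- sumTo n b) (ℚ.+-identityʳ (sumTo n h)) ⟩
  sumTo n h - sumTo n b                  ≡⟨ sumTo-- n h b ⟨
  sumTo n (λ k → h k - b k)              ∎
  where open ≡-Reasoning

sumTo-reverse : ∀ n (f : ℕ → ℚ) → sumTo n (λ i → f (n ∸ i)) ≡ sumTo n f
sumTo-reverse zero    f = refl
sumTo-reverse (suc n) f = begin
  sumTo (suc n) (λ i → f (suc n ∸ i))   ≡⟨ sumTo-head n (λ i → f (suc n ∸ i)) ⟩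
  f (suc n) + sumTo n (λ i → f (n ∸ i))  ≡⟨ cong (f (suc n) +_) (sumTo-reverse n f) ⟩
  f (suc n) + sumTo n f                  ≡⟨ ℚ.+-comm (f (suc n)) (sumTo n f) ⟩
  sumTo n f + f (suc n)                  ∎
  where open ≡-Reasoning

sumTo-comm : ∀ n p (f : ℕ → ℕ → ℚ) →
             sumTo n (λ i → sumTo p (f i)) ≡ sumTo p (λ j → sumTo n (λ i → f i j))
sumTo-comm zero    p f = refl
sumTo-comm (suc n) p f =
  trans (cong (_+ sumTo p (f (suc n))) (sumTo-comm n p f))
        (sym (sumTo-+ p (λ j → sumTo n (λ i → f i j)) (f (suc n))))

sumTo-triangle : ∀ n (f : ℕ → ℕ → ℚ) →
  sumTo n (λ i → sumTo i (f i)) ≡ sumTo n (λ j → sumTo (n ∸ j) (λ l → f (j ℕ.+ l) j))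
sumTo-triangle zero    f = refl
sumTo-triangle (suc n) f = begin
  sumTo n (λ i → sumTo i (f i)) + sumTo (suc n) (f (suc n))
    ≡⟨ cong (_+ sumTo (suc n) (f (suc n))) (sumTo-triangle n f) ⟩
  sumTo n column + (sumTo n (f (suc n)) + f (suc n) (suc n))
    ≡⟨ ℚ.+-assoc (sumTo n column) _ _ ⟨
  (sumTo n column + sumTo n (f (suc n))) + f (suc n) (suc n)
    ≡⟨ cong₂ _+_ (sym (sumTo-+ n column (f (suc n)))) lastColumn ⟩
  sumTo n (λ j → column j + f (suc n) j) + column′ (suc n)
    ≡⟨ cong (_+ column′ (suc n)) (sumTo-cong n extendColumn) ⟩
  sumTo n column′ + column′ (suc n)
    ∎
  where
  open ≡-Reasoning
  column column′ : ℕ → ℚ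
  column  j = sumTo (n ∸ j) (λ l → f (j ℕ.+ l) j)
  column′ j = sumTo (suc n ∸ j) (λ l → f (j ℕ.+ l) j)
  lastColumn : f (suc n) (suc n) ≡ column′ (suc n)
  lastColumn = begin
    f (suc n) (suc n)          ≡⟨ cong (λ i → f i (suc n)) (ℕ.+-identityʳ (suc n)) ⟨
    f (suc n ℕ.+ 0) (suc n)    ≡⟨ cong (λ b → sumTo b (λ l → f (suc n ℕ.+ l) (suc n))) (ℕ.n∸n≡0 n) ⟨
    column′ (suc n)            ∎
  extendColumn : ∀ j → j ≤ n → column j + f (suc n) j ≡ column′ j
  extendColumn j j≤n = begin
    column j + f (suc n) j                   ≡⟨ cong (λ i → column j + f i j) suc-n≡j+suc[n∸j] ⟩
    column j + f (j ℕ.+ suc (n ∸ j)) j       ≡⟨ cong (λ b → sumTo b (λ l → f (j ℕ.+ l) j)) (ℕ.+-∸-assoc 1 j≤n) ⟨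
    column′ j                                ∎
    where
    suc-n≡j+suc[n∸j] : suc n ≡ j ℕ.+ suc (n ∸ j)
    suc-n≡j+suc[n∸j] = sym (trans (ℕ.+-suc j (n ∸ j)) (cong suc (ℕ.m+[n∸m]≡n j≤n)))

sumTo-truncate : ∀ k n (f : ℕ → ℚ) → k ≤ n → (∀ i → k < i → f i ≡ 0ℚ) → sumTo n f ≡ sumTo k f
sumTo-truncate k n f k≤n f≡0 = begin
  sumTo n f                ≡⟨ cong (λ b → sumTo b f) (ℕ.m∸n+n≡m k≤n) ⟨
  sumTo (n ∸ k ℕ.+ k) f    ≡⟨ dropTail (n ∸ k) ⟩
  sumTo k f                ∎
  where
  open ≡-Reasoning
  dropTail : ∀ d → sumTo (d ℕ.+ k) f ≡ sumTo k f
  dropTail zero    = refl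
  dropTail (suc d) = begin
    sumTo (d ℕ.+ k) f + f (suc (d ℕ.+ k))  ≡⟨ cong₂ _+_ (dropTail d) (f≡0 _ (s≤s (ℕ.m≤n+m k d))) ⟩
    sumTo k f + 0ℚ                         ≡⟨ ℚ.+-identityʳ (sumTo k f) ⟩
    sumTo k f                              ∎

-- Formal power series

infixl 6 _⊕_

_⊕_ : Series → Series → Series
(f ⊕ g) n = f n + g n

shiftS : Series → Series
shiftS f zero    = 0ℚ
shiftS f (suc n) = f n

derivS : Series → Series
derivS f n = ℕ→ℚ (suc n) * f (suc n)

⊛-congˡ : ∀ {f f′} g → f ≗ f′ → f ⊛ g ≗ f′ ⊛ g
⊛-congˡ g f≗f′ n = sumTo-cong n (λ i _ → cong (_* g (n ∸ i)) (f≗f′ i))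

⊛-congʳ : ∀ f {g g′} → g ≗ g′ → f ⊛ g ≗ f ⊛ g′
⊛-congʳ f g≗g′ n = sumTo-cong n (λ i _ → cong (f i *_) (g≗g′ (n ∸ i)))

⊛-comm : ∀ f g → f ⊛ g ≗ g ⊛ f
⊛-comm f g n = begin
  sumTo n (λ i → f i * g (n ∸ i))              ≡⟨ sumTo-reverse n (λ i → f i * g (n ∸ i)) ⟨
  sumTo n (λ i → f (n ∸ i) * g (n ∸ (n ∸ i)))  ≡⟨ sumTo-cong n swap ⟩
  sumTo n (λ i → g i * f (n ∸ i))              ∎
  where
  open ≡-Reasoning
  swap : ∀ i → i ≤ n → f (n ∸ i) * g (n ∸ (n ∸ i)) ≡ g i * f (n ∸ i)
  swap i i≤n = trans (cong (λ k → f (n ∸ i) * g k) (ℕ.m∸[m∸n]≡n i≤n)) (ℚ.*-comm (f (n ∸ i)) (g i))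

⊛-identityˡ : ∀ f → oneS ⊛ f ≗ f
⊛-identityˡ f zero    = ℚ.*-identityˡ (f 0)
⊛-identityˡ f (suc n) = begin
  (oneS ⊛ f) (suc n)                                 ≡⟨ sumTo-head n (λ i → oneS i * f (suc n ∸ i)) ⟩
  1ℚ * f (suc n) + sumTo n (λ i → 0ℚ * f (n ∸ i))    ≡⟨ cong₂ _+_ (ℚ.*-identityˡ (f (suc n))) tail≡0 ⟩
  f (suc n) + 0ℚ                                     ≡⟨ ℚ.+-identityʳ (f (suc n)) ⟩
  f (suc n)                                          ∎
  where
  open ≡-Reasoning
  tail≡0 : sumTo n (λ i → 0ℚ * f (n ∸ i)) ≡ 0ℚ
  tail≡0 = trans (sumTo-cong n (λ i _ → ℚ.*-zeroˡ (f (n ∸ i)))) (sumTo-0 n)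

⊛-zeroʳ : ∀ f → f ⊛ const 0ℚ ≗ const 0ℚ
⊛-zeroʳ f n = trans (sumTo-cong n (λ i _ → ℚ.*-zeroʳ (f i))) (sumTo-0 n)

⊛-distribˡ-⊕ : ∀ f g h → f ⊛ (g ⊕ h) ≗ f ⊛ g ⊕ f ⊛ h
⊛-distribˡ-⊕ f g h n =
  trans (sumTo-cong n (λ i _ → ℚ.*-distribˡ-+ (f i) (g (n ∸ i)) (h (n ∸ i))))
        (sumTo-+ n (λ i → f i * g (n ∸ i)) (λ i → f i * h (n ∸ i)))

⊛-distribʳ-⊕ : ∀ f g h → (g ⊕ h) ⊛ f ≗ g ⊛ f ⊕ h ⊛ f
⊛-distribʳ-⊕ f g h n =
  trans (sumTo-cong n (λ i _ → ℚ.*-distribʳ-+ (f (n ∸ i)) (g i) (h i)))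
        (sumTo-+ n (λ i → g i * f (n ∸ i)) (λ i → h i * f (n ∸ i)))

scale-⊛ : ∀ c f g → scale c f ⊛ g ≗ scale c (f ⊛ g)
scale-⊛ c f g n =
  trans (sumTo-cong n (λ i _ → ℚ.*-assoc c (f i) (g (n ∸ i)))) (sumTo-*ˡ n c (λ i → f i * g (n ∸ i)))

⊛-scale : ∀ c f g → f ⊛ scale c g ≗ scale c (f ⊛ g)
⊛-scale c f g n =
  trans (sumTo-cong n (λ i _ → x∙yz≈y∙xz (f i) c (g (n ∸ i)))) (sumTo-*ˡ n c (λ i → f i * g (n ∸ i)))

shiftS-⊛ : ∀ f g → shiftS f ⊛ g ≗ shiftS (f ⊛ g)
shiftS-⊛ f g zero    = ℚ.*-zeroˡ (g 0)
shiftS-⊛ f g (suc n) =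
  trans (sumTo-head n (λ i → shiftS f i * g (suc n ∸ i)))
        (trans (cong (_+ (f ⊛ g) n) (ℚ.*-zeroˡ (g (suc n)))) (ℚ.+-identityˡ ((f ⊛ g) n)))

⊛-assoc : ∀ f g h → (f ⊛ g) ⊛ h ≗ f ⊛ (g ⊛ h)
⊛-assoc f g h n = begin
  sumTo n (λ i → sumTo i (λ j → f j * g (i ∸ j)) * h (n ∸ i))
    ≡⟨ sumTo-cong n (λ i _ → sym (sumTo-*ʳ i (h (n ∸ i)) (λ j → f j * g (i ∸ j)))) ⟩
  sumTo n (λ i → sumTo i (λ j → f j * g (i ∸ j) * h (n ∸ i)))
    ≡⟨ sumTo-triangle n (λ i j → f j * g (i ∸ j) * h (n ∸ i)) ⟩
  sumTo n (λ j → sumTo (n ∸ j) (λ l → f j * g (j ℕ.+ l ∸ j) * h (n ∸ (j ℕ.+ l))))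
    ≡⟨ sumTo-cong n (λ j _ → sumTo-cong (n ∸ j) (λ l _ → reindex j l)) ⟩
  sumTo n (λ j → sumTo (n ∸ j) (λ l → f j * (g l * h (n ∸ j ∸ l))))
    ≡⟨ sumTo-cong n (λ j _ → sumTo-*ˡ (n ∸ j) (f j) (λ l → g l * h (n ∸ j ∸ l))) ⟩
  sumTo n (λ j → f j * sumTo (n ∸ j) (λ l → g l * h (n ∸ j ∸ l)))
    ∎
  where
  open ≡-Reasoning
  reindex : ∀ j l → f j * g (j ℕ.+ l ∸ j) * h (n ∸ (j ℕ.+ l)) ≡ f j * (g l * h (n ∸ j ∸ l))
  reindex j l = trans (cong₂ (λ a b → f j * g a * h b) (ℕ.m+n∸m≡n j l) (sym (ℕ.∸-+-assoc n j l)))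
                      (ℚ.*-assoc (f j) (g l) (h (n ∸ j ∸ l)))

derivS-⊛ : ∀ f g → derivS (f ⊛ g) ≗ derivS f ⊛ g ⊕ f ⊛ derivS g
derivS-⊛ f g n = begin
  ℕ→ℚ (suc n) * (f ⊛ g) (suc n)
    ≡⟨ sumTo-*ˡ (suc n) (ℕ→ℚ (suc n)) (λ i → f i * g (suc n ∸ i)) ⟨
  sumTo (suc n) (λ i → ℕ→ℚ (suc n) * (f i * g (suc n ∸ i)))
    ≡⟨ sumTo-cong (suc n) productRule ⟩
  sumTo (suc n) (λ i → shiftS (derivS f) i * g (suc n ∸ i) + f i * shiftS (derivS g) (suc n ∸ i))
    ≡⟨ sumTo-+ (suc n) (λ i → shiftS (derivS f) i * g (suc n ∸ i)) (λ i → f i * shiftS (derivS g) (suc n ∸ i)) ⟩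
  (shiftS (derivS f) ⊛ g) (suc n) + (f ⊛ shiftS (derivS g)) (suc n)
    ≡⟨ cong₂ _+_ (shiftS-⊛ (derivS f) g (suc n))
                 (trans (⊛-comm f (shiftS (derivS g)) (suc n)) (shiftS-⊛ (derivS g) f (suc n))) ⟩
  (derivS f ⊛ g) n + (derivS g ⊛ f) n
    ≡⟨ cong ((derivS f ⊛ g) n +_) (⊛-comm (derivS g) f n) ⟩
  (derivS f ⊛ g) n + (f ⊛ derivS g) n
    ∎
  where
  open ≡-Reasoning
  t*derivS : ∀ h i → ℕ→ℚ i * h i ≡ shiftS (derivS h) i
  t*derivS h zero    = ℚ.*-zeroˡ (h 0)
  t*derivS h (suc i) = refl
  distribute : ∀ a b x y → (a + b) * (x * y) ≡ a * x * y + x * (b * y)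
  distribute = solve-∀ ℚ-ring
  productRule : ∀ i → i ≤ suc n →
    ℕ→ℚ (suc n) * (f i * g (suc n ∸ i)) ≡ shiftS (derivS f) i * g (suc n ∸ i) + f i * shiftS (derivS g) (suc n ∸ i)
  productRule i i≤1+n = begin
    ℕ→ℚ (suc n) * (f i * g k)                ≡⟨ cong (λ N → ℕ→ℚ N * (f i * g k)) (ℕ.m+[n∸m]≡n i≤1+n) ⟨
    ℕ→ℚ (i ℕ.+ k) * (f i * g k)              ≡⟨ cong (_* (f i * g k)) (ℕ→ℚ-+ i k) ⟩
    (ℕ→ℚ i + ℕ→ℚ k) * (f i * g k)            ≡⟨ distribute (ℕ→ℚ i) (ℕ→ℚ k) (f i) (g k) ⟩
    ℕ→ℚ i * f i * g k + f i * (ℕ→ℚ k * g k)  ≡⟨ cong₂ (λ a b → a * g k + f i * b) (t*derivS f i) (t*derivS g k) ⟩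
    shiftS (derivS f) i * g k + f i * shiftS (derivS g) k ∎
    where k = suc n ∸ i

derivS-oneS : derivS oneS ≗ const 0ℚ
derivS-oneS n = ℚ.*-zeroʳ (ℕ→ℚ (suc n))

derivS-powS : ∀ u j → derivS (powS u (suc j)) ≗ scale (ℕ→ℚ (suc j)) (derivS u ⊛ powS u j)
derivS-powS u zero n = begin
  derivS (u ⊛ oneS) n                          ≡⟨ derivS-⊛ u oneS n ⟩
  (derivS u ⊛ oneS) n + (u ⊛ derivS oneS) n    ≡⟨ cong ((derivS u ⊛ oneS) n +_) u⊛0≡0 ⟩
  (derivS u ⊛ oneS) n + 0ℚ                     ≡⟨ ℚ.+-identityʳ _ ⟩
  (derivS u ⊛ oneS) n                          ≡⟨ ℚ.*-identityˡ _ ⟨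
  1ℚ * (derivS u ⊛ oneS) n                     ∎
  where
  open ≡-Reasoning
  u⊛0≡0 : (u ⊛ derivS oneS) n ≡ 0ℚ
  u⊛0≡0 = trans (⊛-congʳ u {derivS oneS} derivS-oneS n) (⊛-zeroʳ u n)
derivS-powS u (suc j) n = begin
  derivS (u ⊛ powS u (suc j)) n
    ≡⟨ derivS-⊛ u (powS u (suc j)) n ⟩
  X + (u ⊛ derivS (powS u (suc j))) n
    ≡⟨ cong (X +_) (⊛-congʳ u (derivS-powS u j) n) ⟩
  X + (u ⊛ scale c (derivS u ⊛ powS u j)) n
    ≡⟨ cong (X +_) (⊛-scale c u (derivS u ⊛ powS u j) n) ⟩
  X + c * (u ⊛ (derivS u ⊛ powS u j)) n
    ≡⟨ cong (λ z → X + c * z) exchange ⟩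
  X + c * X
    ≡⟨ regroup c X ⟩
  (1ℚ + c) * X
    ≡⟨ cong (_* X) (ℕ→ℚ-suc (suc j)) ⟨
  ℕ→ℚ (suc (suc j)) * X
    ∎
  where
  open ≡-Reasoning
  c = ℕ→ℚ (suc j)
  X = (derivS u ⊛ powS u (suc j)) n
  regroup : ∀ a x → x + a * x ≡ (1ℚ + a) * x
  regroup = solve-∀ ℚ-ring
  exchange : (u ⊛ (derivS u ⊛ powS u j)) n ≡ X
  exchange = begin
    (u ⊛ (derivS u ⊛ powS u j)) n   ≡⟨ ⊛-assoc u (derivS u) (powS u j) n ⟨
    ((u ⊛ derivS u) ⊛ powS u j) n   ≡⟨ ⊛-congˡ (powS u j) (⊛-comm u (derivS u)) n ⟩
    ((derivS u ⊛ u) ⊛ powS u j) n   ≡⟨ ⊛-assoc (derivS u) u (powS u j) n ⟩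
    X                               ∎

derivS-expS : ∀ c → derivS (expS c) ≗ scale c (expS c)
derivS-expS c n = begin
  ℕ→ℚ (suc n) * (c * c ^ᵠ n * inv! (suc n))    ≡⟨ regroup (ℕ→ℚ (suc n)) c (c ^ᵠ n) (inv! (suc n)) ⟩
  c * (c ^ᵠ n * (ℕ→ℚ (suc n) * inv! (suc n)))  ≡⟨ cong (λ z → c * (c ^ᵠ n * z)) ([1+n]*inv![1+n]≡inv!n n) ⟩
  c * (c ^ᵠ n * inv! n)                        ∎
  where
  open ≡-Reasoning
  regroup : ∀ a c p i → a * (c * p * i) ≡ c * (p * (a * i))
  regroup = solve-∀ ℚ-ring

derivS-expm1S : derivS expm1S ≗ expm1S ⊕ oneS
derivS-expm1S zero    = [1+n]*inv![1+n]≡inv!n 0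
derivS-expm1S (suc n) = trans ([1+n]*inv![1+n]≡inv!n (suc n)) (sym (ℚ.+-identityʳ _))

derivS-invOneMinusT : derivS invOneMinusT ≗ invOneMinusT ⊛ invOneMinusT
derivS-invOneMinusT n = sym (sumTo-const n 1ℚ)

n!*derivS : ∀ f n → ℕ→ℚ (suc n !) * f (suc n) ≡ ℕ→ℚ (n !) * derivS f n
n!*derivS f n = begin
  ℕ→ℚ (suc n ℕ.* n !) * f (suc n)        ≡⟨ cong (_* f (suc n)) (ℕ→ℚ-* (suc n) (n !)) ⟩
  ℕ→ℚ (suc n) * ℕ→ℚ (n !) * f (suc n)    ≡⟨ xy∙z≈y∙xz (ℕ→ℚ (suc n)) (ℕ→ℚ (n !)) (f (suc n)) ⟩
  ℕ→ℚ (n !) * derivS f n                 ∎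
  where open ≡-Reasoning

-- r-Stirling numbers

ℕ→ℚ-rStirling2-suc : ∀ s n j → ℕ→ℚ (rStirling2 s (suc n) (suc j)) ≡
  ℕ→ℚ (rStirling2 s n j) + (ℕ→ℚ (suc j) + ℕ→ℚ s) * ℕ→ℚ (rStirling2 s n (suc j))
ℕ→ℚ-rStirling2-suc s n j = begin
  ℕ→ℚ (S j ℕ.+ (suc j ℕ.+ s) ℕ.* S (suc j))          ≡⟨ ℕ→ℚ-+ (S j) _ ⟩
  ℕ→ℚ (S j) + ℕ→ℚ ((suc j ℕ.+ s) ℕ.* S (suc j))      ≡⟨ cong (ℕ→ℚ (S j) +_) (ℕ→ℚ-* (suc j ℕ.+ s) (S (suc j))) ⟩
  ℕ→ℚ (S j) + ℕ→ℚ (suc j ℕ.+ s) * ℕ→ℚ (S (suc j))    ≡⟨ cong (λ z → ℕ→ℚ (S j) + z * ℕ→ℚ (S (suc j))) (ℕ→ℚ-+ (suc j) s) ⟩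
  ℕ→ℚ (S j) + (ℕ→ℚ (suc j) + ℕ→ℚ s) * ℕ→ℚ (S (suc j)) ∎
  where
  open ≡-Reasoning
  S = rStirling2 s n

n<k⇒rStirling2≡0 : ∀ m n k → n < k → rStirling2 m n k ≡ 0
n<k⇒rStirling2≡0 m zero    (suc k) _         = refl
n<k⇒rStirling2≡0 m (suc n) (suc k) (s≤s n<k)
  rewrite n<k⇒rStirling2≡0 m n k n<k | n<k⇒rStirling2≡0 m n (suc k) (ℕ.m<n⇒m<1+n n<k) = ℕ.*-zeroʳ (suc k ℕ.+ m)

rStirling2-unique : ∀ s c (b : ℕ → ℕ → ℚ) →
  b 0 0 ≡ 1ℚ →
  (∀ j → b 0 (suc j) ≡ 0ℚ) →
  (∀ n → b (suc n) 0 ≡ ℕ→ℚ s * b n 0) →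
  (∀ n j → b (suc n) (suc j) ≡ (ℕ→ℚ s + ℕ→ℚ (suc j)) * b n (suc j) + c * ℕ→ℚ (suc j) * b n j) →
  ∀ n j → b n j ≡ c ^ᵠ j * (ℕ→ℚ (j !) * ℕ→ℚ (rStirling2 s n j))
rStirling2-unique s c b b₀₀ b₀ bᵢ₀ bᵢ zero zero = b₀₀
rStirling2-unique s c b b₀₀ b₀ bᵢ₀ bᵢ zero (suc j) =
  trans (b₀ j) (sym (trans (cong (c ^ᵠ suc j *_) (ℚ.*-zeroʳ (ℕ→ℚ (suc j !)))) (ℚ.*-zeroʳ (c ^ᵠ suc j))))
rStirling2-unique s c b b₀₀ b₀ bᵢ₀ bᵢ (suc n) zero = begin
  b (suc n) 0                               ≡⟨ bᵢ₀ n ⟩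
  ℕ→ℚ s * b n 0                             ≡⟨ cong (ℕ→ℚ s *_) (rStirling2-unique s c b b₀₀ b₀ bᵢ₀ bᵢ n 0) ⟩
  ℕ→ℚ s * (1ℚ * (1ℚ * ℕ→ℚ (rStirling2 s n 0))) ≡⟨ regroup (ℕ→ℚ s) (ℕ→ℚ (rStirling2 s n 0)) ⟩
  1ℚ * (1ℚ * (ℕ→ℚ s * ℕ→ℚ (rStirling2 s n 0))) ≡⟨ cong (λ z → 1ℚ * (1ℚ * z)) (ℕ→ℚ-* s (rStirling2 s n 0)) ⟨
  1ℚ * (1ℚ * ℕ→ℚ (s ℕ.* rStirling2 s n 0))  ∎
  where
  open ≡-Reasoning
  regroup : ∀ s S → s * (1ℚ * (1ℚ * S)) ≡ 1ℚ * (1ℚ * (s * S))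
  regroup = solve-∀ ℚ-ring
rStirling2-unique s c b b₀₀ b₀ bᵢ₀ bᵢ (suc n) (suc j) = begin
  b (suc n) (suc j)
    ≡⟨ bᵢ n j ⟩
  (σ + a) * b n (suc j) + c * a * b n j
    ≡⟨ cong₂ (λ u v → (σ + a) * u + c * a * v) (recurse (suc j)) (recurse j) ⟩
  (σ + a) * (c * C * (ℕ→ℚ (suc j !) * S₁)) + c * a * (C * (J * S₀))
    ≡⟨ cong (λ z → (σ + a) * (c * C * (z * S₁)) + c * a * (C * (J * S₀))) (ℕ→ℚ-* (suc j) (j !)) ⟩
  (σ + a) * (c * C * (a * J * S₁)) + c * a * (C * (J * S₀))
    ≡⟨ regroup σ a c C J S₀ S₁ ⟩
  c * C * (a * J * (S₀ + (a + σ) * S₁))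
    ≡⟨ cong₂ (λ u v → c * C * (u * v)) (ℕ→ℚ-* (suc j) (j !)) (ℕ→ℚ-rStirling2-suc s n j) ⟨
  c * C * (ℕ→ℚ (suc j !) * ℕ→ℚ (rStirling2 s (suc n) (suc j)))
    ∎
  where
  open ≡-Reasoning
  recurse = rStirling2-unique s c b b₀₀ b₀ bᵢ₀ bᵢ n
  σ = ℕ→ℚ s
  a = ℕ→ℚ (suc j)
  C = c ^ᵠ j
  J = ℕ→ℚ (j !)
  S₀ = ℕ→ℚ (rStirling2 s n j)
  S₁ = ℕ→ℚ (rStirling2 s n (suc j))
  regroup : ∀ σ a c C J S₀ S₁ →
    (σ + a) * (c * C * (a * J * S₁)) + c * a * (C * (J * S₀)) ≡ c * C * (a * J * (S₀ + (a + σ) * S₁))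
  regroup = solve-∀ ℚ-ring

-- The r-geometric polynomials

stirlingEGF : ℕ → ℕ → Series
stirlingEGF s j = expS (ℕ→ℚ s) ⊛ powS expm1S j

derivS-expS-⊛ : ∀ c f → derivS (expS c ⊛ f) ≗ scale c (expS c ⊛ f) ⊕ expS c ⊛ derivS f
derivS-expS-⊛ c f n =
  trans (derivS-⊛ (expS c) f n)
        (cong (_+ (expS c ⊛ derivS f) n) (trans (⊛-congˡ f (derivS-expS c) n) (scale-⊛ c (expS c) f n)))

derivS-stirlingEGF-zero : ∀ s → derivS (stirlingEGF s 0) ≗ scale (ℕ→ℚ s) (stirlingEGF s 0)
derivS-stirlingEGF-zero s n = begin
  derivS (stirlingEGF s 0) n                                     ≡⟨ derivS-expS-⊛ (ℕ→ℚ s) oneS n ⟩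
  ℕ→ℚ s * stirlingEGF s 0 n + (expS (ℕ→ℚ s) ⊛ derivS oneS) n     ≡⟨ cong (ℕ→ℚ s * stirlingEGF s 0 n +_) e⊛0≡0 ⟩
  ℕ→ℚ s * stirlingEGF s 0 n + 0ℚ                                 ≡⟨ ℚ.+-identityʳ _ ⟩
  ℕ→ℚ s * stirlingEGF s 0 n                                      ∎
  where
  open ≡-Reasoning
  e⊛0≡0 : (expS (ℕ→ℚ s) ⊛ derivS oneS) n ≡ 0ℚ
  e⊛0≡0 = trans (⊛-congʳ (expS (ℕ→ℚ s)) {derivS oneS} derivS-oneS n) (⊛-zeroʳ (expS (ℕ→ℚ s)) n)

-- d/dt (eᵗ − 1)^{j+1} = (j+1)(eᵗ − 1)ʲ eᵗ, and eᵗ = (eᵗ − 1) + 1.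
derivS-stirlingEGF-suc : ∀ s j → derivS (stirlingEGF s (suc j)) ≗
  scale (ℕ→ℚ s + ℕ→ℚ (suc j)) (stirlingEGF s (suc j)) ⊕ scale (ℕ→ℚ (suc j)) (stirlingEGF s j)
derivS-stirlingEGF-suc s j n = begin
  derivS (e ⊛ E^ (suc j)) n
    ≡⟨ derivS-expS-⊛ (ℕ→ℚ s) (E^ (suc j)) n ⟩
  ℕ→ℚ s * V₁ + (e ⊛ derivS (E^ (suc j))) n
    ≡⟨ cong (ℕ→ℚ s * V₁ +_) (trans (⊛-congʳ e (derivS-powS expm1S j) n) (⊛-scale a e (derivS expm1S ⊛ E^ j) n)) ⟩
  ℕ→ℚ s * V₁ + a * (e ⊛ (derivS expm1S ⊛ E^ j)) n
    ≡⟨ cong (λ z → ℕ→ℚ s * V₁ + a * z) chainRule ⟩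
  ℕ→ℚ s * V₁ + a * (V₁ + V₀)
    ≡⟨ regroup (ℕ→ℚ s) a V₁ V₀ ⟩
  (ℕ→ℚ s + a) * V₁ + a * V₀
    ∎
  where
  open ≡-Reasoning
  e = expS (ℕ→ℚ s)
  E^ = powS expm1S
  a = ℕ→ℚ (suc j)
  V₁ = stirlingEGF s (suc j) n
  V₀ = stirlingEGF s j n
  regroup : ∀ σ a x y → σ * x + a * (x + y) ≡ (σ + a) * x + a * y
  regroup = solve-∀ ℚ-ring
  derivS-expm1S⊛ : derivS expm1S ⊛ E^ j ≗ E^ (suc j) ⊕ E^ j
  derivS-expm1S⊛ m = begin
    (derivS expm1S ⊛ E^ j) m               ≡⟨ ⊛-congˡ (E^ j) derivS-expm1S m ⟩
    ((expm1S ⊕ oneS) ⊛ E^ j) m             ≡⟨ ⊛-distribʳ-⊕ (E^ j) expm1S oneS m ⟩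
    E^ (suc j) m + (oneS ⊛ E^ j) m         ≡⟨ cong (E^ (suc j) m +_) (⊛-identityˡ (E^ j) m) ⟩
    E^ (suc j) m + E^ j m                  ∎
  chainRule : (e ⊛ (derivS expm1S ⊛ E^ j)) n ≡ V₁ + V₀
  chainRule = trans (⊛-congʳ e derivS-expm1S⊛ n) (⊛-distribˡ-⊕ e (E^ (suc j)) (E^ j) n)

stirlingEGF-coeff : ∀ s n j → ℕ→ℚ (n !) * stirlingEGF s j n ≡ ℕ→ℚ (j !) * ℕ→ℚ (rStirling2 s n j)
stirlingEGF-coeff s n j = begin
  b n j                                              ≡⟨ rStirling2-unique s 1ℚ b refl b₀ bᵢ₀ bᵢ n j ⟩
  1ℚ ^ᵠ j * (ℕ→ℚ (j !) * ℕ→ℚ (rStirling2 s n j))     ≡⟨ cong (_* (ℕ→ℚ (j !) * ℕ→ℚ (rStirling2 s n j))) (^ᵠ-zeroˡ j) ⟩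
  1ℚ * (ℕ→ℚ (j !) * ℕ→ℚ (rStirling2 s n j))          ≡⟨ ℚ.*-identityˡ _ ⟩
  ℕ→ℚ (j !) * ℕ→ℚ (rStirling2 s n j)                 ∎
  where
  open ≡-Reasoning
  b : ℕ → ℕ → ℚ
  b n j = ℕ→ℚ (n !) * stirlingEGF s j n
  b₀ : ∀ j → b 0 (suc j) ≡ 0ℚ
  b₀ j = cong (λ z → ℕ→ℚ 1 * (expS (ℕ→ℚ s) 0 * z)) (ℚ.*-zeroˡ (powS expm1S j 0))
  bᵢ₀ : ∀ n → b (suc n) 0 ≡ ℕ→ℚ s * b n 0
  bᵢ₀ n = begin
    b (suc n) 0                                ≡⟨ n!*derivS (stirlingEGF s 0) n ⟩
    ℕ→ℚ (n !) * derivS (stirlingEGF s 0) n     ≡⟨ cong (ℕ→ℚ (n !) *_) (derivS-stirlingEGF-zero s n) ⟩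
    ℕ→ℚ (n !) * (ℕ→ℚ s * stirlingEGF s 0 n)    ≡⟨ x∙yz≈y∙xz (ℕ→ℚ (n !)) (ℕ→ℚ s) _ ⟩
    ℕ→ℚ s * b n 0                              ∎
  bᵢ : ∀ n j → b (suc n) (suc j) ≡ (ℕ→ℚ s + ℕ→ℚ (suc j)) * b n (suc j) + 1ℚ * ℕ→ℚ (suc j) * b n j
  bᵢ n j = begin
    b (suc n) (suc j)                                   ≡⟨ n!*derivS (stirlingEGF s (suc j)) n ⟩
    ℕ→ℚ (n !) * derivS (stirlingEGF s (suc j)) n        ≡⟨ cong (ℕ→ℚ (n !) *_) (derivS-stirlingEGF-suc s j n) ⟩
    ℕ→ℚ (n !) * ((ℕ→ℚ s + a) * V₁ + a * V₀)             ≡⟨ distribute (ℕ→ℚ (n !)) (ℕ→ℚ s + a) a V₁ V₀ ⟩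
    (ℕ→ℚ s + a) * b n (suc j) + 1ℚ * a * b n j          ∎
    where
    a = ℕ→ℚ (suc j)
    V₁ = stirlingEGF s (suc j) n
    V₀ = stirlingEGF s j n
    distribute : ∀ f c a x y → f * (c * x + a * y) ≡ c * (f * x) + 1ℚ * a * (f * y)
    distribute = solve-∀ ℚ-ring

powS-coeff-< : ∀ u → u 0 ≡ 0ℚ → ∀ j i → i < j → powS u j i ≡ 0ℚ
powS-coeff-< u u₀≡0 (suc j) i i<1+j = trans (sumTo-cong i term≡0) (sumTo-0 i)
  where
  term≡0 : ∀ l → l ≤ i → u l * powS u j (i ∸ l) ≡ 0ℚ
  term≡0 zero    _ = trans (cong (_* powS u j i) u₀≡0) (ℚ.*-zeroˡ (powS u j i))
  term≡0 (suc l) l<i =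
    trans (cong (u (suc l) *_) (powS-coeff-< u u₀≡0 j (i ∸ suc l) i∸[1+l]<j)) (ℚ.*-zeroʳ (u (suc l)))
    where
    i∸[1+l]<j : i ∸ suc l < j
    i∸[1+l]<j = ℕ.<-≤-trans (ℕ.∸-monoʳ-< (s≤s z≤n) l<i) (ℕ.≤-pred i<1+j)

powS-scale : ∀ c u j → powS (scale c u) j ≗ scale (c ^ᵠ j) (powS u j)
powS-scale c u zero    n = sym (ℚ.*-identityˡ (oneS n))
powS-scale c u (suc j) n = begin
  (scale c u ⊛ powS (scale c u) j) n           ≡⟨ ⊛-congʳ (scale c u) (powS-scale c u j) n ⟩
  (scale c u ⊛ scale (c ^ᵠ j) (powS u j)) n    ≡⟨ ⊛-scale (c ^ᵠ j) (scale c u) (powS u j) n ⟩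
  c ^ᵠ j * (scale c u ⊛ powS u j) n            ≡⟨ cong (c ^ᵠ j *_) (scale-⊛ c u (powS u j) n) ⟩
  c ^ᵠ j * (c * (u ⊛ powS u j) n)              ≡⟨ ℚ.*-assoc (c ^ᵠ j) c _ ⟨
  c ^ᵠ j * c * (u ⊛ powS u j) n                ≡⟨ cong (_* (u ⊛ powS u j) n) (ℚ.*-comm (c ^ᵠ j) c) ⟩
  c * c ^ᵠ j * (u ⊛ powS u j) n                ∎
  where open ≡-Reasoning

⊛-geomS : ∀ e u → u 0 ≡ 0ℚ → ∀ n → (e ⊛ geomS u) n ≡ sumTo n (λ j → (e ⊛ powS u j) n)
⊛-geomS e u u₀≡0 n = begin
  sumTo n (λ l → e l * sumTo (n ∸ l) (λ j → powS u j (n ∸ l)))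
    ≡⟨ sumTo-cong n (λ l _ → cong (e l *_) (sym (extend l))) ⟩
  sumTo n (λ l → e l * sumTo n (λ j → powS u j (n ∸ l)))
    ≡⟨ sumTo-cong n (λ l _ → sym (sumTo-*ˡ n (e l) (λ j → powS u j (n ∸ l)))) ⟩
  sumTo n (λ l → sumTo n (λ j → e l * powS u j (n ∸ l)))
    ≡⟨ sumTo-comm n n (λ l j → e l * powS u j (n ∸ l)) ⟩
  sumTo n (λ j → (e ⊛ powS u j) n)
    ∎
  where
  open ≡-Reasoning
  extend : ∀ l → sumTo n (λ j → powS u j (n ∸ l)) ≡ sumTo (n ∸ l) (λ j → powS u j (n ∸ l))
  extend l = sumTo-truncate (n ∸ l) n (λ j → powS u j (n ∸ l)) (ℕ.m∸n≤m n l)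
                            (λ j → powS-coeff-< u u₀≡0 j (n ∸ l))

rGeom-expansion : ∀ n s z → rGeom n s z ≡ sumTo n (λ j → z ^ᵠ j * (ℕ→ℚ (j !) * ℕ→ℚ (rStirling2 s n j)))
rGeom-expansion n s z = begin
  ℕ→ℚ (n !) * (e ⊛ geomS (scale z expm1S)) n
    ≡⟨ cong (ℕ→ℚ (n !) *_) (⊛-geomS e (scale z expm1S) (ℚ.*-zeroʳ z) n) ⟩
  ℕ→ℚ (n !) * sumTo n (λ j → (e ⊛ powS (scale z expm1S) j) n)
    ≡⟨ sumTo-*ˡ n (ℕ→ℚ (n !)) _ ⟨
  sumTo n (λ j → ℕ→ℚ (n !) * (e ⊛ powS (scale z expm1S) j) n)
    ≡⟨ sumTo-cong n (λ j _ → term j) ⟩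
  sumTo n (λ j → z ^ᵠ j * (ℕ→ℚ (j !) * ℕ→ℚ (rStirling2 s n j)))
    ∎
  where
  open ≡-Reasoning
  e = expS (ℕ→ℚ s)
  term : ∀ j → ℕ→ℚ (n !) * (e ⊛ powS (scale z expm1S) j) n ≡ z ^ᵠ j * (ℕ→ℚ (j !) * ℕ→ℚ (rStirling2 s n j))
  term j = begin
    ℕ→ℚ (n !) * (e ⊛ powS (scale z expm1S) j) n          ≡⟨ cong (ℕ→ℚ (n !) *_) (⊛-congʳ e (powS-scale z expm1S j) n) ⟩
    ℕ→ℚ (n !) * (e ⊛ scale (z ^ᵠ j) (powS expm1S j)) n   ≡⟨ cong (ℕ→ℚ (n !) *_) (⊛-scale (z ^ᵠ j) e (powS expm1S j) n) ⟩
    ℕ→ℚ (n !) * (z ^ᵠ j * stirlingEGF s j n)             ≡⟨ x∙yz≈y∙xz (ℕ→ℚ (n !)) (z ^ᵠ j) _ ⟩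
    z ^ᵠ j * (ℕ→ℚ (n !) * stirlingEGF s j n)             ≡⟨ cong (z ^ᵠ j *_) (stirlingEGF-coeff s n j) ⟩
    z ^ᵠ j * (ℕ→ℚ (j !) * ℕ→ℚ (rStirling2 s n j))        ∎

-- The geometric r-Lah polynomials at x − 1

negBinomS : ℕ → Series
negBinomS α = powS invOneMinusT α

negBinomS-coeff-0 : ∀ α → negBinomS α 0 ≡ 1ℚ
negBinomS-coeff-0 zero    = refl
negBinomS-coeff-0 (suc α) = trans (ℚ.*-identityˡ (negBinomS α 0)) (negBinomS-coeff-0 α)

invOneMinusT-⊛-suc : ∀ f l → (invOneMinusT ⊛ f) (suc l) ≡ f (suc l) + (invOneMinusT ⊛ f) l
invOneMinusT-⊛-suc f l =
  trans (sumTo-head l (λ i → 1ℚ * f (suc l ∸ i))) (cong (_+ (invOneMinusT ⊛ f) l) (ℚ.*-identityˡ (f (suc l))))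

derivS-negBinomS : ∀ α → derivS (negBinomS (suc α)) ≗ scale (ℕ→ℚ (suc α)) (negBinomS (suc (suc α)))
derivS-negBinomS α n = begin
  derivS (negBinomS (suc α)) n
    ≡⟨ derivS-powS invOneMinusT α n ⟩
  ℕ→ℚ (suc α) * (derivS invOneMinusT ⊛ negBinomS α) n
    ≡⟨ cong (ℕ→ℚ (suc α) *_) (⊛-congˡ (negBinomS α) derivS-invOneMinusT n) ⟩
  ℕ→ℚ (suc α) * ((invOneMinusT ⊛ invOneMinusT) ⊛ negBinomS α) n
    ≡⟨ cong (ℕ→ℚ (suc α) *_) (⊛-assoc invOneMinusT invOneMinusT (negBinomS α) n) ⟩
  ℕ→ℚ (suc α) * negBinomS (suc (suc α)) n
    ∎
  where open ≡-Reasoning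

negBinomS-rec : ∀ α l → ℕ→ℚ (suc l) * negBinomS α (suc l) ≡ (ℕ→ℚ l + ℕ→ℚ α) * negBinomS α l
negBinomS-rec zero    zero    = refl
negBinomS-rec zero    (suc l) = trans (ℚ.*-zeroʳ (ℕ→ℚ (suc (suc l)))) (sym (ℚ.*-zeroʳ (ℕ→ℚ (suc l) + 0ℚ)))
negBinomS-rec (suc α) zero    = begin
  derivS (negBinomS (suc α)) 0                ≡⟨ derivS-negBinomS α 0 ⟩
  ℕ→ℚ (suc α) * (1ℚ * negBinomS (suc α) 0)    ≡⟨ cong (ℕ→ℚ (suc α) *_) (ℚ.*-identityˡ _) ⟩
  ℕ→ℚ (suc α) * negBinomS (suc α) 0           ≡⟨ cong (_* negBinomS (suc α) 0) (ℚ.+-identityˡ (ℕ→ℚ (suc α))) ⟨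
  (0ℚ + ℕ→ℚ (suc α)) * negBinomS (suc α) 0    ∎
  where open ≡-Reasoning
negBinomS-rec (suc α) (suc l) = begin
  derivS Q (suc l)                                     ≡⟨ derivS-negBinomS α (suc l) ⟩
  a * (invOneMinusT ⊛ Q) (suc l)                       ≡⟨ cong (a *_) (invOneMinusT-⊛-suc Q l) ⟩
  a * (Q (suc l) + (invOneMinusT ⊛ Q) l)               ≡⟨ ℚ.*-distribˡ-+ a (Q (suc l)) _ ⟩
  a * Q (suc l) + a * (invOneMinusT ⊛ Q) l             ≡⟨ cong (a * Q (suc l) +_) (derivS-negBinomS α l) ⟨
  a * Q (suc l) + ℕ→ℚ (suc l) * Q (suc l)              ≡⟨ ℚ.*-distribʳ-+ (Q (suc l)) a (ℕ→ℚ (suc l)) ⟨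
  (a + ℕ→ℚ (suc l)) * Q (suc l)                        ≡⟨ cong (_* Q (suc l)) (ℚ.+-comm a (ℕ→ℚ (suc l))) ⟩
  (ℕ→ℚ (suc l) + a) * Q (suc l)                        ∎
  where
  open ≡-Reasoning
  Q = negBinomS (suc α)
  a = ℕ→ℚ (suc α)

tOverOneMinusT-⊛ : ∀ f → tOverOneMinusT ⊛ f ≗ shiftS (invOneMinusT ⊛ f)
tOverOneMinusT-⊛ f n = trans (⊛-congˡ f t/[1-t]≗t*1/[1-t] n) (shiftS-⊛ invOneMinusT f n)
  where
  t/[1-t]≗t*1/[1-t] : tOverOneMinusT ≗ shiftS invOneMinusT
  t/[1-t]≗t*1/[1-t] zero    = refl
  t/[1-t]≗t*1/[1-t] (suc _) = refl

tOverOneMinusT-⊛-suc : ∀ f k → (tOverOneMinusT ⊛ f) (suc k) ≡ (tOverOneMinusT ⊛ f) k + f k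
tOverOneMinusT-⊛-suc f zero = begin
  (tOverOneMinusT ⊛ f) 1          ≡⟨ tOverOneMinusT-⊛ f 1 ⟩
  1ℚ * f 0                        ≡⟨ ℚ.*-identityˡ (f 0) ⟩
  f 0                             ≡⟨ ℚ.+-identityˡ (f 0) ⟨
  0ℚ + f 0                        ≡⟨ cong (_+ f 0) (tOverOneMinusT-⊛ f 0) ⟨
  (tOverOneMinusT ⊛ f) 0 + f 0    ∎
  where open ≡-Reasoning
tOverOneMinusT-⊛-suc f (suc k) = begin
  (tOverOneMinusT ⊛ f) (suc (suc k))        ≡⟨ tOverOneMinusT-⊛ f (suc (suc k)) ⟩
  (invOneMinusT ⊛ f) (suc k)                ≡⟨ invOneMinusT-⊛-suc f k ⟩
  f (suc k) + (invOneMinusT ⊛ f) k          ≡⟨ ℚ.+-comm (f (suc k)) _ ⟩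
  (invOneMinusT ⊛ f) k + f (suc k)          ≡⟨ cong (_+ f (suc k)) (tOverOneMinusT-⊛ f (suc k)) ⟨
  (tOverOneMinusT ⊛ f) (suc k) + f (suc k)  ∎
  where open ≡-Reasoning

lahColumnS : ℕ → ℕ → Series
lahColumnS R i = powS tOverOneMinusT i ⊛ negBinomS R

lahColumnS-suc : ∀ R i → lahColumnS R (suc i) ≗ tOverOneMinusT ⊛ lahColumnS R i
lahColumnS-suc R i = ⊛-assoc tOverOneMinusT (powS tOverOneMinusT i) (negBinomS R)

lahColumnS-rec : ∀ R i k → lahColumnS R (suc i) (suc k) ≡ lahColumnS R (suc i) k + lahColumnS R i k
lahColumnS-rec R i k = begin
  lahColumnS R (suc i) (suc k)                             ≡⟨ lahColumnS-suc R i (suc k) ⟩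
  (tOverOneMinusT ⊛ lahColumnS R i) (suc k)                ≡⟨ tOverOneMinusT-⊛-suc (lahColumnS R i) k ⟩
  (tOverOneMinusT ⊛ lahColumnS R i) k + lahColumnS R i k   ≡⟨ cong (_+ lahColumnS R i k) (lahColumnS-suc R i k) ⟨
  lahColumnS R (suc i) k + lahColumnS R i k                ∎
  where open ≡-Reasoning

lahColumnS-coeff-< : ∀ R i k → k < i → lahColumnS R i k ≡ 0ℚ
lahColumnS-coeff-< R (suc i) zero    _         = trans (lahColumnS-suc R i 0) (tOverOneMinusT-⊛ (lahColumnS R i) 0)
lahColumnS-coeff-< R (suc i) (suc k) (s≤s k<i) = begin
  lahColumnS R (suc i) (suc k)               ≡⟨ lahColumnS-rec R i k ⟩
  lahColumnS R (suc i) k + lahColumnS R i k  ≡⟨ cong₂ _+_ (lahColumnS-coeff-< R (suc i) k (ℕ.m<n⇒m<1+n k<i))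
                                                         (lahColumnS-coeff-< R i k k<i) ⟩
  0ℚ + 0ℚ                                    ≡⟨ ℚ.+-identityʳ 0ℚ ⟩
  0ℚ                                         ∎
  where open ≡-Reasoning

lahGF : ℕ → ℚ → ℕ → ℚ
lahGF R y k = sumTo k (λ i → y ^ᵠ i * lahColumnS R i k)

geomLah≡k!*lahGF : ∀ k r y → geomLah k r y ≡ ℕ→ℚ (k !) * lahGF (2 ℕ.* r) y k
geomLah≡k!*lahGF k r y = trans (sumTo-cong k (λ i _ → term i)) (sumTo-*ˡ k (ℕ→ℚ (k !)) _)
  where
  open ≡-Reasoning
  regroup : ∀ a v h w Y → a * (v * h) * w * Y ≡ a * (Y * h) * (w * v)
  regroup = solve-∀ ℚ-ring
  term : ∀ i → rLah r k i * ℕ→ℚ (i !) * y ^ᵠ i ≡ ℕ→ℚ (k !) * (y ^ᵠ i * lahColumnS (2 ℕ.* r) i k)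
  term i = begin
    ℕ→ℚ (k !) * (inv! i * H) * ℕ→ℚ (i !) * y ^ᵠ i    ≡⟨ regroup (ℕ→ℚ (k !)) (inv! i) H (ℕ→ℚ (i !)) (y ^ᵠ i) ⟩
    ℕ→ℚ (k !) * (y ^ᵠ i * H) * (ℕ→ℚ (i !) * inv! i)  ≡⟨ cong (ℕ→ℚ (k !) * (y ^ᵠ i * H) *_) (n!*inv!≡1 i) ⟩
    ℕ→ℚ (k !) * (y ^ᵠ i * H) * 1ℚ                    ≡⟨ ℚ.*-identityʳ _ ⟩
    ℕ→ℚ (k !) * (y ^ᵠ i * H)                         ∎
    where H = lahColumnS (2 ℕ.* r) i k

lahGF-head : ∀ R y k → lahGF R y k ≡ 1ℚ * negBinomS R k + sumTo k (λ i → y ^ᵠ suc i * lahColumnS R (suc i) k)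
lahGF-head R y k = begin
  lahGF R y k                                          ≡⟨ ℚ.+-identityʳ (lahGF R y k) ⟨
  lahGF R y k + 0ℚ                                     ≡⟨ cong (lahGF R y k +_) top≡0 ⟨
  sumTo (suc k) (λ i → y ^ᵠ i * lahColumnS R i k)      ≡⟨ sumTo-head k (λ i → y ^ᵠ i * lahColumnS R i k) ⟩
  1ℚ * lahColumnS R 0 k + A                            ≡⟨ cong (λ u → 1ℚ * u + A) (⊛-identityˡ (negBinomS R) k) ⟩
  1ℚ * negBinomS R k + A                               ∎
  where
  open ≡-Reasoning
  A = sumTo k (λ i → y ^ᵠ suc i * lahColumnS R (suc i) k)
  top≡0 : y ^ᵠ suc k * lahColumnS R (suc k) k ≡ 0ℚ
  top≡0 = trans (cong (y ^ᵠ suc k *_) (lahColumnS-coeff-< R (suc k) k (ℕ.n<1+n k))) (ℚ.*-zeroʳ (y ^ᵠ suc k))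

lahGF-suc : ∀ α y k → lahGF (suc α) y (suc k) ≡ negBinomS α (suc k) + (1ℚ + y) * lahGF (suc α) y k
lahGF-suc α y k = begin
  lahGF R y (suc k)
    ≡⟨ sumTo-head k (λ i → y ^ᵠ i * H i (suc k)) ⟩
  1ℚ * H 0 (suc k) + sumTo k (λ i → y ^ᵠ suc i * H (suc i) (suc k))
    ≡⟨ cong₂ (λ u v → 1ℚ * u + v) H₀-suc (sumTo-cong k (λ i _ → H-suc i)) ⟩
  1ℚ * (p + q) + sumTo k (λ i → y ^ᵠ suc i * H (suc i) k + y * (y ^ᵠ i * H i k))
    ≡⟨ cong (1ℚ * (p + q) +_) (sumTo-+ k _ _) ⟩
  1ℚ * (p + q) + (A + sumTo k (λ i → y * (y ^ᵠ i * H i k)))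
    ≡⟨ cong (λ z → 1ℚ * (p + q) + (A + z)) (sumTo-*ˡ k y (λ i → y ^ᵠ i * H i k)) ⟩
  1ℚ * (p + q) + (A + y * lahGF R y k)
    ≡⟨ regroup p q A y (lahGF R y k) ⟩
  p + ((1ℚ * q + A) + y * lahGF R y k)
    ≡⟨ cong (λ z → p + (z + y * lahGF R y k)) (lahGF-head R y k) ⟨
  p + (lahGF R y k + y * lahGF R y k)
    ≡⟨ cong (p +_) (regroup′ y (lahGF R y k)) ⟩
  p + (1ℚ + y) * lahGF R y k
    ∎
  where
  open ≡-Reasoning
  R = suc α
  H = lahColumnS R
  p = negBinomS α (suc k)
  q = negBinomS R k
  A = sumTo k (λ i → y ^ᵠ suc i * H (suc i) k)
  regroup : ∀ p q A y Φ → 1ℚ * (p + q) + (A + y * Φ) ≡ p + ((1ℚ * q + A) + y * Φ)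
  regroup = solve-∀ ℚ-ring
  regroup′ : ∀ y Φ → Φ + y * Φ ≡ (1ℚ + y) * Φ
  regroup′ = solve-∀ ℚ-ring
  H₀-suc : H 0 (suc k) ≡ p + q
  H₀-suc = trans (⊛-identityˡ (negBinomS R) (suc k)) (invOneMinusT-⊛-suc (negBinomS α) k)
  H-suc : ∀ i → y ^ᵠ suc i * H (suc i) (suc k) ≡ y ^ᵠ suc i * H (suc i) k + y * (y ^ᵠ i * H i k)
  H-suc i = begin
    y ^ᵠ suc i * H (suc i) (suc k)                       ≡⟨ cong (y ^ᵠ suc i *_) (lahColumnS-rec R i k) ⟩
    y ^ᵠ suc i * (H (suc i) k + H i k)                   ≡⟨ ℚ.*-distribˡ-+ (y ^ᵠ suc i) _ _ ⟩
    y ^ᵠ suc i * H (suc i) k + y * y ^ᵠ i * H i k        ≡⟨ cong (y ^ᵠ suc i * H (suc i) k +_) (ℚ.*-assoc y (y ^ᵠ i) (H i k)) ⟩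
    y ^ᵠ suc i * H (suc i) k + y * (y ^ᵠ i * H i k)      ∎

shiftsS : ℕ → Series → Series
shiftsS zero    f = f
shiftsS (suc j) f = shiftS (shiftsS j f)

shiftsS-coeff-< : ∀ j f k → k < j → shiftsS j f k ≡ 0ℚ
shiftsS-coeff-< (suc j) f zero    _         = refl
shiftsS-coeff-< (suc j) f (suc k) (s≤s k<j) = shiftsS-coeff-< j f k k<j

shiftsS-negBinomS-rec : ∀ α j k →
  (ℕ→ℚ (suc k) - ℕ→ℚ j) * shiftsS j (negBinomS α) (suc k) ≡ (ℕ→ℚ k + ℕ→ℚ α - ℕ→ℚ j) * shiftsS j (negBinomS α) k
shiftsS-negBinomS-rec α zero k = begin
  (ℕ→ℚ (suc k) - 0ℚ) * negBinomS α (suc k)       ≡⟨ cong (_* negBinomS α (suc k)) (x-0≡x (ℕ→ℚ (suc k))) ⟩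
  ℕ→ℚ (suc k) * negBinomS α (suc k)              ≡⟨ negBinomS-rec α k ⟩
  (ℕ→ℚ k + ℕ→ℚ α) * negBinomS α k                ≡⟨ cong (_* negBinomS α k) (x-0≡x (ℕ→ℚ k + ℕ→ℚ α)) ⟨
  (ℕ→ℚ k + ℕ→ℚ α - 0ℚ) * negBinomS α k           ∎
  where
  open ≡-Reasoning
  x-0≡x : ∀ x → x - 0ℚ ≡ x
  x-0≡x = solve-∀ ℚ-ring
shiftsS-negBinomS-rec α (suc zero) zero =
  trans (ℚ.*-zeroˡ (negBinomS α 0)) (sym (ℚ.*-zeroʳ (ℕ→ℚ 0 + ℕ→ℚ α - ℕ→ℚ 1)))
shiftsS-negBinomS-rec α (suc (suc j)) zero =
  trans (ℚ.*-zeroʳ (ℕ→ℚ 1 - ℕ→ℚ (suc (suc j)))) (sym (ℚ.*-zeroʳ (ℕ→ℚ 0 + ℕ→ℚ α - ℕ→ℚ (suc (suc j)))))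
shiftsS-negBinomS-rec α (suc j) (suc k) = begin
  (ℕ→ℚ (suc (suc k)) - ℕ→ℚ (suc j)) * shiftsS j P (suc k)    ≡⟨ cong (_* shiftsS j P (suc k)) (cancel (suc k) j) ⟩
  (ℕ→ℚ (suc k) - ℕ→ℚ j) * shiftsS j P (suc k)                ≡⟨ shiftsS-negBinomS-rec α j k ⟩
  (ℕ→ℚ k + ℕ→ℚ α - ℕ→ℚ j) * shiftsS j P k                    ≡⟨ cong (_* shiftsS j P k) shifted ⟩
  (ℕ→ℚ (suc k) + ℕ→ℚ α - ℕ→ℚ (suc j)) * shiftsS j P k        ∎
  where
  open ≡-Reasoning
  P = negBinomS α
  1+a-[1+b]≡a-b : ∀ a b → (1ℚ + a) - (1ℚ + b) ≡ a - b
  1+a-[1+b]≡a-b = solve-∀ ℚ-ring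
  a+c-b≡1+a+c-[1+b] : ∀ a b c → a + c - b ≡ (1ℚ + a) + c - (1ℚ + b)
  a+c-b≡1+a+c-[1+b] = solve-∀ ℚ-ring
  cancel : ∀ a b → ℕ→ℚ (suc a) - ℕ→ℚ (suc b) ≡ ℕ→ℚ a - ℕ→ℚ b
  cancel a b = trans (cong₂ _-_ (ℕ→ℚ-suc a) (ℕ→ℚ-suc b)) (1+a-[1+b]≡a-b (ℕ→ℚ a) (ℕ→ℚ b))
  shifted : ℕ→ℚ k + ℕ→ℚ α - ℕ→ℚ j ≡ ℕ→ℚ (suc k) + ℕ→ℚ α - ℕ→ℚ (suc j)
  shifted = trans (a+c-b≡1+a+c-[1+b] (ℕ→ℚ k) (ℕ→ℚ j) (ℕ→ℚ α))
                  (sym (cong₂ (λ u v → u + ℕ→ℚ α - v) (ℕ→ℚ-suc k) (ℕ→ℚ-suc j)))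

negBinomGeomGF : ℕ → ℚ → ℕ → ℚ
negBinomGeomGF α x k = sumTo k (λ j → x ^ᵠ j * shiftsS j (negBinomS α) k)

negBinomGeomGF-suc : ∀ α x k → negBinomGeomGF α x (suc k) ≡ negBinomS α (suc k) + x * negBinomGeomGF α x k
negBinomGeomGF-suc α x k =
  trans (sumTo-head k (λ j → x ^ᵠ j * shiftsS j (negBinomS α) (suc k)))
        (cong₂ _+_ (ℚ.*-identityˡ (negBinomS α (suc k)))
                   (trans (sumTo-cong k (λ j _ → ℚ.*-assoc x (x ^ᵠ j) _)) (sumTo-*ˡ k x _)))

lahGF-at-x-1 : ∀ α x k → lahGF (suc α) (x - 1ℚ) k ≡ negBinomGeomGF α x k
lahGF-at-x-1 α x zero = begin
  1ℚ * (1ℚ * negBinomS (suc α) 0)   ≡⟨ ℚ.*-identityˡ _ ⟩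
  1ℚ * negBinomS (suc α) 0          ≡⟨ ℚ.*-identityˡ _ ⟩
  negBinomS (suc α) 0               ≡⟨ negBinomS-coeff-0 (suc α) ⟩
  1ℚ                                ≡⟨ negBinomS-coeff-0 α ⟨
  negBinomS α 0                     ≡⟨ ℚ.*-identityˡ _ ⟨
  1ℚ * negBinomS α 0                ∎
  where open ≡-Reasoning
lahGF-at-x-1 α x (suc k) = begin
  lahGF (suc α) (x - 1ℚ) (suc k)
    ≡⟨ lahGF-suc α (x - 1ℚ) k ⟩
  negBinomS α (suc k) + (1ℚ + (x - 1ℚ)) * lahGF (suc α) (x - 1ℚ) k
    ≡⟨ cong₂ (λ u v → negBinomS α (suc k) + u * v) (1+[x-1]≡x x) (lahGF-at-x-1 α x k) ⟩
  negBinomS α (suc k) + x * negBinomGeomGF α x k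
    ≡⟨ negBinomGeomGF-suc α x k ⟨
  negBinomGeomGF α x (suc k)
    ∎
  where
  open ≡-Reasoning
  1+[x-1]≡x : ∀ x → 1ℚ + (x - 1ℚ) ≡ x
  1+[x-1]≡x = solve-∀ ℚ-ring

lahWeight : ℕ → ℕ → ℕ → ℚ
lahWeight α j k = ℕ→ℚ (k !) * shiftsS j (negBinomS α) k

geomLah-at-x-1 : ∀ r α → 2 ℕ.* r ≡ suc α → ∀ k x →
  geomLah k r (x - 1ℚ) ≡ sumTo k (λ j → x ^ᵠ j * lahWeight α j k)
geomLah-at-x-1 r α 2r≡1+α k x = begin
  geomLah k r (x - 1ℚ)                                           ≡⟨ geomLah≡k!*lahGF k r (x - 1ℚ) ⟩
  ℕ→ℚ (k !) * lahGF (2 ℕ.* r) (x - 1ℚ) k                         ≡⟨ cong (λ R → ℕ→ℚ (k !) * lahGF R (x - 1ℚ) k) 2r≡1+α ⟩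
  ℕ→ℚ (k !) * lahGF (suc α) (x - 1ℚ) k                           ≡⟨ cong (ℕ→ℚ (k !) *_) (lahGF-at-x-1 α x k) ⟩
  ℕ→ℚ (k !) * negBinomGeomGF α x k                               ≡⟨ sumTo-*ˡ k (ℕ→ℚ (k !)) _ ⟨
  sumTo k (λ j → ℕ→ℚ (k !) * (x ^ᵠ j * shiftsS j (negBinomS α) k)) ≡⟨ sumTo-cong k (λ j _ → x∙yz≈y∙xz (ℕ→ℚ (k !)) (x ^ᵠ j) _) ⟩
  sumTo k (λ j → x ^ᵠ j * lahWeight α j k)                       ∎
  where open ≡-Reasoning

-- Alternating r-Stirling sums

altStirlingSum : ℕ → ℕ → (ℕ → ℚ) → ℚ
altStirlingSum m n a = sumTo n (λ k → -1^ k * ℕ→ℚ (rStirling2 m n k) * a k)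

altStirlingSum-cong : ∀ m n {a b : ℕ → ℚ} → (∀ k → k ≤ n → a k ≡ b k) → altStirlingSum m n a ≡ altStirlingSum m n b
altStirlingSum-cong m n a≡b = sumTo-cong n (λ k k≤n → cong (-1^ k * ℕ→ℚ (rStirling2 m n k) *_) (a≡b k k≤n))

altStirlingSum-linear : ∀ m n c d (f g : ℕ → ℚ) →
  altStirlingSum m n (λ k → c * f k - d * g k) ≡ c * altStirlingSum m n f - d * altStirlingSum m n g
altStirlingSum-linear m n c d f g = begin
  sumTo n (λ k → w k * (c * f k - d * g k))               ≡⟨ sumTo-cong n (λ k _ → distribute (w k) c d (f k) (g k)) ⟩
  sumTo n (λ k → c * (w k * f k) - d * (w k * g k))       ≡⟨ sumTo-- n _ _ ⟩
  sumTo n (λ k → c * (w k * f k)) - sumTo n (λ k → d * (w k * g k))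
    ≡⟨ cong₂ _-_ (sumTo-*ˡ n c (λ k → w k * f k)) (sumTo-*ˡ n d (λ k → w k * g k)) ⟩
  c * altStirlingSum m n f - d * altStirlingSum m n g     ∎
  where
  open ≡-Reasoning
  w : ℕ → ℚ
  w k = -1^ k * ℕ→ℚ (rStirling2 m n k)
  distribute : ∀ w c d x y → w * (c * x - d * y) ≡ c * (w * x) - d * (w * y)
  distribute = solve-∀ ℚ-ring

altStirlingSum-sumTo : ∀ m n p (c : ℕ → ℚ) (f : ℕ → ℕ → ℚ) →
  altStirlingSum m n (λ k → sumTo p (λ j → c j * f j k)) ≡ sumTo p (λ j → c j * altStirlingSum m n (f j))
altStirlingSum-sumTo m n p c f = begin
  sumTo n (λ k → w k * sumTo p (λ j → c j * f j k))
    ≡⟨ sumTo-cong n (λ k _ → sym (sumTo-*ˡ p (w k) (λ j → c j * f j k))) ⟩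
  sumTo n (λ k → sumTo p (λ j → w k * (c j * f j k)))
    ≡⟨ sumTo-comm n p (λ k j → w k * (c j * f j k)) ⟩
  sumTo p (λ j → sumTo n (λ k → w k * (c j * f j k)))
    ≡⟨ sumTo-cong p (λ j _ → trans (sumTo-cong n (λ k _ → x∙yz≈y∙xz (w k) (c j) (f j k))) (sumTo-*ˡ n (c j) (λ k → w k * f j k))) ⟩
  sumTo p (λ j → c j * altStirlingSum m n (f j))
    ∎
  where
  open ≡-Reasoning
  w : ℕ → ℚ
  w k = -1^ k * ℕ→ℚ (rStirling2 m n k)

stirlingΔ : ℕ → (ℕ → ℚ) → (ℕ → ℚ)
stirlingΔ m a k = (ℕ→ℚ k + ℕ→ℚ m) * a k - a (suc k)

-- Summation by parts against {n+1,k+1}_m = {n,k}_m + (k+1+m) {n,k+1}_m.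
altStirlingSum-suc : ∀ m n a → altStirlingSum m (suc n) a ≡ altStirlingSum m n (stirlingΔ m a)
altStirlingSum-suc m n a = begin
  altStirlingSum m (suc n) a
    ≡⟨ sumTo-head n (λ k → -1^ k * ℕ→ℚ (rStirling2 m (suc n) k) * a k) ⟩
  1ℚ * ℕ→ℚ (m ℕ.* S 0) * a 0 + sumTo n (λ k → -1^ suc k * ℕ→ℚ (rStirling2 m (suc n) (suc k)) * a (suc k))
    ≡⟨ cong₂ _+_ head (sumTo-cong n (λ k _ → term k)) ⟩
  h 0 + sumTo n (λ k → h (suc k) - b k)
    ≡⟨ sumTo-shift-sub n h b h[1+n]≡0 ⟩
  sumTo n (λ k → h k - b k)
    ≡⟨ sumTo-cong n (λ k _ → factor (-1^ k) (ℕ→ℚ k) (ℕ→ℚ m) (ℕ→ℚ (S k)) (a k) (a (suc k))) ⟩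
  altStirlingSum m n (stirlingΔ m a)
    ∎
  where
  open ≡-Reasoning
  S = rStirling2 m n
  h b : ℕ → ℚ
  h k = -1^ k * (ℕ→ℚ k + ℕ→ℚ m) * ℕ→ℚ (S k) * a k
  b k = -1^ k * ℕ→ℚ (S k) * a (suc k)
  h[1+n]≡0 : h (suc n) ≡ 0ℚ
  h[1+n]≡0 = begin
    -1^ suc n * (ℕ→ℚ (suc n) + ℕ→ℚ m) * ℕ→ℚ (S (suc n)) * a (suc n)
      ≡⟨ cong (λ z → -1^ suc n * (ℕ→ℚ (suc n) + ℕ→ℚ m) * ℕ→ℚ z * a (suc n)) (n<k⇒rStirling2≡0 m n (suc n) (ℕ.n<1+n n)) ⟩
    -1^ suc n * (ℕ→ℚ (suc n) + ℕ→ℚ m) * 0ℚ * a (suc n)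
      ≡⟨ cong (_* a (suc n)) (ℚ.*-zeroʳ (-1^ suc n * (ℕ→ℚ (suc n) + ℕ→ℚ m))) ⟩
    0ℚ * a (suc n)
      ≡⟨ ℚ.*-zeroˡ (a (suc n)) ⟩
    0ℚ ∎
  head : 1ℚ * ℕ→ℚ (m ℕ.* S 0) * a 0 ≡ h 0
  head = trans (cong (λ z → 1ℚ * z * a 0) (ℕ→ℚ-* m (S 0))) (regroup (ℕ→ℚ m) (ℕ→ℚ (S 0)) (a 0))
    where
    regroup : ∀ m s a → 1ℚ * (m * s) * a ≡ 1ℚ * (0ℚ + m) * s * a
    regroup = solve-∀ ℚ-ring
  term : ∀ k → -1^ suc k * ℕ→ℚ (rStirling2 m (suc n) (suc k)) * a (suc k) ≡ h (suc k) - b k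
  term k = trans (cong (λ z → -1^ suc k * z * a (suc k)) (ℕ→ℚ-rStirling2-suc m n k))
                 (distribute (-1^ k) (ℕ→ℚ (suc k) + ℕ→ℚ m) (ℕ→ℚ (S k)) (ℕ→ℚ (S (suc k))) (a (suc k)))
    where
    distribute : ∀ σ c S₀ S₁ x → - 1ℚ * σ * (S₀ + c * S₁) * x ≡ - 1ℚ * σ * c * S₁ * x - σ * S₀ * x
    distribute = solve-∀ ℚ-ring
  factor : ∀ σ k m s x y → σ * (k + m) * s * x - σ * s * y ≡ σ * s * ((k + m) * x - y)
  factor = solve-∀ ℚ-ring

stirlingΔ-lahWeight : ∀ s α j k → stirlingΔ (s ℕ.+ α) (lahWeight α j) k ≡
  (ℕ→ℚ s + ℕ→ℚ j) * lahWeight α j k - ℕ→ℚ j * (ℕ→ℚ (k !) * shiftsS j (negBinomS α) (suc k))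
stirlingΔ-lahWeight s α j k = begin
  (κ + ℕ→ℚ (s ℕ.+ α)) * (K * A) - ℕ→ℚ (suc k ℕ.* k !) * B
    ≡⟨ cong₂ (λ u v → (κ + u) * (K * A) - v * B) (ℕ→ℚ-+ s α) (trans (ℕ→ℚ-* (suc k) (k !)) (cong (_* K) (ℕ→ℚ-suc k))) ⟩
  (κ + (σ + α′)) * (K * A) - (1ℚ + κ) * K * B
    ≡⟨ cong (λ z → (κ + (σ + α′)) * (K * A) - z) (split κ ι K B) ⟩
  (κ + (σ + α′)) * (K * A) - (K * ((1ℚ + κ - ι) * B) + ι * (K * B))
    ≡⟨ cong (λ z → (κ + (σ + α′)) * (K * A) - (K * z + ι * (K * B))) recurrence ⟩
  (κ + (σ + α′)) * (K * A) - (K * ((κ + α′ - ι) * A) + ι * (K * B))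
    ≡⟨ cancel κ σ α′ ι K A B ⟩
  (σ + ι) * (K * A) - ι * (K * B)
    ∎
  where
  open ≡-Reasoning
  κ = ℕ→ℚ k
  σ = ℕ→ℚ s
  α′ = ℕ→ℚ α
  ι = ℕ→ℚ j
  K = ℕ→ℚ (k !)
  A = shiftsS j (negBinomS α) k
  B = shiftsS j (negBinomS α) (suc k)
  split : ∀ κ ι K B → (1ℚ + κ) * K * B ≡ K * ((1ℚ + κ - ι) * B) + ι * (K * B)
  split = solve-∀ ℚ-ring
  recurrence : (1ℚ + κ - ι) * B ≡ (κ + α′ - ι) * A
  recurrence = trans (cong (λ z → (z - ι) * B) (sym (ℕ→ℚ-suc k))) (shiftsS-negBinomS-rec α j k)
  cancel : ∀ κ σ α ι K A B →
    (κ + (σ + α)) * (K * A) - (K * ((κ + α - ι) * A) + ι * (K * B)) ≡ (σ + ι) * (K * A) - ι * (K * B)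
  cancel = solve-∀ ℚ-ring

altStirlingSum-lahWeight-suc : ∀ s α n j → altStirlingSum (s ℕ.+ α) (suc n) (lahWeight α j) ≡
  (ℕ→ℚ s + ℕ→ℚ j) * altStirlingSum (s ℕ.+ α) n (lahWeight α j)
    - ℕ→ℚ j * altStirlingSum (s ℕ.+ α) n (λ k → ℕ→ℚ (k !) * shiftsS j (negBinomS α) (suc k))
altStirlingSum-lahWeight-suc s α n j = begin
  altStirlingSum m (suc n) (lahWeight α j)
    ≡⟨ altStirlingSum-suc m n (lahWeight α j) ⟩
  altStirlingSum m n (stirlingΔ m (lahWeight α j))
    ≡⟨ altStirlingSum-cong m n (λ k _ → stirlingΔ-lahWeight s α j k) ⟩
  altStirlingSum m n (λ k → (ℕ→ℚ s + ℕ→ℚ j) * lahWeight α j k - ℕ→ℚ j * (ℕ→ℚ (k !) * shiftsS j (negBinomS α) (suc k)))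
    ≡⟨ altStirlingSum-linear m n (ℕ→ℚ s + ℕ→ℚ j) (ℕ→ℚ j) _ _ ⟩
  (ℕ→ℚ s + ℕ→ℚ j) * altStirlingSum m n (lahWeight α j)
    - ℕ→ℚ j * altStirlingSum m n (λ k → ℕ→ℚ (k !) * shiftsS j (negBinomS α) (suc k))
    ∎
  where
  open ≡-Reasoning
  m = s ℕ.+ α

altStirlingSum-lahWeight : ∀ s α n j →
  altStirlingSum (s ℕ.+ α) n (lahWeight α j) ≡ -1^ j * (ℕ→ℚ (j !) * ℕ→ℚ (rStirling2 s n j))
altStirlingSum-lahWeight s α = rStirling2-unique s (- 1ℚ) b b₀₀ (λ _ → refl) bᵢ₀ bᵢ
  where
  b : ℕ → ℕ → ℚ
  b n j = altStirlingSum (s ℕ.+ α) n (lahWeight α j)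
  b₀₀ : b 0 0 ≡ 1ℚ
  b₀₀ = cong (λ z → 1ℚ * ℕ→ℚ 1 * (ℕ→ℚ 1 * z)) (negBinomS-coeff-0 α)
  bᵢ₀ : ∀ n → b (suc n) 0 ≡ ℕ→ℚ s * b n 0
  bᵢ₀ n = trans (altStirlingSum-lahWeight-suc s α n 0)
                (cancel (ℕ→ℚ s) (b n 0) (altStirlingSum (s ℕ.+ α) n (λ k → ℕ→ℚ (k !) * negBinomS α (suc k))))
    where
    cancel : ∀ σ x y → (σ + 0ℚ) * x - 0ℚ * y ≡ σ * x
    cancel = solve-∀ ℚ-ring
  bᵢ : ∀ n j → b (suc n) (suc j) ≡ (ℕ→ℚ s + ℕ→ℚ (suc j)) * b n (suc j) + - 1ℚ * ℕ→ℚ (suc j) * b n j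
  bᵢ n j = trans (altStirlingSum-lahWeight-suc s α n (suc j))
                 (negate (ℕ→ℚ s + ℕ→ℚ (suc j)) (ℕ→ℚ (suc j)) (b n (suc j)) (b n j))
    where
    negate : ∀ c a x y → c * x - a * y ≡ c * x + - 1ℚ * a * y
    negate = solve-∀ ℚ-ring

altStirlingSum-geomLah : ∀ s α r → 2 ℕ.* r ≡ suc α → ∀ n x →
  altStirlingSum (s ℕ.+ α) n (λ k → geomLah k r (x - 1ℚ))
    ≡ sumTo n (λ j → x ^ᵠ j * (-1^ j * (ℕ→ℚ (j !) * ℕ→ℚ (rStirling2 s n j))))
altStirlingSum-geomLah s α r 2r≡1+α n x = begin
  altStirlingSum (s ℕ.+ α) n (λ k → geomLah k r (x - 1ℚ))
    ≡⟨ altStirlingSum-cong (s ℕ.+ α) n expand ⟩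
  altStirlingSum (s ℕ.+ α) n (λ k → sumTo n (λ j → x ^ᵠ j * lahWeight α j k))
    ≡⟨ altStirlingSum-sumTo (s ℕ.+ α) n n (x ^ᵠ_) (lahWeight α) ⟩
  sumTo n (λ j → x ^ᵠ j * altStirlingSum (s ℕ.+ α) n (lahWeight α j))
    ≡⟨ sumTo-cong n (λ j _ → cong (x ^ᵠ j *_) (altStirlingSum-lahWeight s α n j)) ⟩
  sumTo n (λ j → x ^ᵠ j * (-1^ j * (ℕ→ℚ (j !) * ℕ→ℚ (rStirling2 s n j))))
    ∎
  where
  open ≡-Reasoning
  expand : ∀ k → k ≤ n → geomLah k r (x - 1ℚ) ≡ sumTo n (λ j → x ^ᵠ j * lahWeight α j k)
  expand k k≤n = trans (geomLah-at-x-1 r α 2r≡1+α k x) (sym (sumTo-truncate k n _ k≤n vanish))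
    where
    vanish : ∀ j → k < j → x ^ᵠ j * lahWeight α j k ≡ 0ℚ
    vanish j k<j = begin
      x ^ᵠ j * (ℕ→ℚ (k !) * shiftsS j (negBinomS α) k)  ≡⟨ cong (λ z → x ^ᵠ j * (ℕ→ℚ (k !) * z)) (shiftsS-coeff-< j (negBinomS α) k k<j) ⟩
      x ^ᵠ j * (ℕ→ℚ (k !) * 0ℚ)                         ≡⟨ cong (x ^ᵠ j *_) (ℚ.*-zeroʳ (ℕ→ℚ (k !))) ⟩
      x ^ᵠ j * 0ℚ                                       ≡⟨ ℚ.*-zeroʳ (x ^ᵠ j) ⟩
      0ℚ                                                ∎

m≡[m+1∸R]+[R-1] : ∀ m R → 1 ≤ R → R ≤ m ℕ.+ 1 → m ≡ (m ℕ.+ 1 ∸ R) ℕ.+ ℕ.pred R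
m≡[m+1∸R]+[R-1] m (suc R) _ 1+R≤m+1 = begin
  m                    ≡⟨ ℕ.m∸n+n≡m R≤m ⟨
  m ∸ R ℕ.+ R          ≡⟨ cong (λ k → k ∸ suc R ℕ.+ R) (ℕ.+-comm m 1) ⟨
  m ℕ.+ 1 ∸ suc R ℕ.+ R ∎
  where
  open ≡-Reasoning
  R≤m : R ≤ m
  R≤m = ℕ.≤-pred (subst (suc R ≤_) (ℕ.+-comm m 1) 1+R≤m+1)

mainTheorem13 : (n m r : ℕ) → 1 ≤ n → 1 ≤ 2 Data.Nat.* r → 2 Data.Nat.* r ≤ m Data.Nat.+ 1 → (x : ℚ) →
    sumTo n (λ k → ((- 1ℚ) ^ᵠ k) * ℕ→ℚ (rStirling2 m n k) * geomLah k r (x - 1ℚ))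
      ≡ rGeom n ((m Data.Nat.+ 1) ∸ (2 Data.Nat.* r)) (- x)
mainTheorem13 n m r _ 1≤2r 2r≤m+1 x = begin
  altStirlingSum m n (λ k → geomLah k r (x - 1ℚ))
    ≡⟨ cong (λ m → altStirlingSum m n (λ k → geomLah k r (x - 1ℚ))) (m≡[m+1∸R]+[R-1] m (2 ℕ.* r) 1≤2r 2r≤m+1) ⟩
  altStirlingSum (s ℕ.+ α) n (λ k → geomLah k r (x - 1ℚ))
    ≡⟨ altStirlingSum-geomLah s α r 2r≡1+α n x ⟩
  sumTo n (λ j → x ^ᵠ j * (-1^ j * (ℕ→ℚ (j !) * ℕ→ℚ (rStirling2 s n j))))
    ≡⟨ sumTo-cong n (λ j _ → x^j*[-1^j*q]≡[-x]^j*q x j (ℕ→ℚ (j !) * ℕ→ℚ (rStirling2 s n j))) ⟩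
  sumTo n (λ j → (- x) ^ᵠ j * (ℕ→ℚ (j !) * ℕ→ℚ (rStirling2 s n j)))
    ≡⟨ rGeom-expansion n s (- x) ⟨
  rGeom n s (- x)
    ∎
  where
  open ≡-Reasoning
  s = m ℕ.+ 1 ∸ 2 ℕ.* r
  α = ℕ.pred (2 ℕ.* r)
  2r≡1+α : 2 ℕ.* r ≡ suc α
  2r≡1+α = sym (ℕ.suc-pred (2 ℕ.* r) {{ℕ.>-nonZero 1≤2r}})
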